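{- Let $r\in\mathbb N$, $G$ an abelian group, and $\mathcal A=(A_1,\dots,A_q)$ where for each $i$, $A_i=a_i+M_i$ with $a_i\in G$ and $M_i\subseteq G$ a $K_i$-approximate submonoid for some $K_i\in\mathbb N$. Then for every $\mathbf h=(h_1,\dots,h_q)\in\mathbb N_0^q$ there exists a finite set $X_{\mathbf h}\subseteq G$ such that $(r\mathbf h)\cdot\mathcal A\subseteq X_{\mathbf h}+\mathbf h\cdot\mathcal A$ and \[ |X_{\mathbf h}|\le\prod_{i:\,h_i>0}\binom{(r-1)h_i+K_i-1}{K_i-1}. \] Equivalently, with $K:=\max_iK_i$, $|X_{\mathbf h}|\le\prod_{i:\,h_i>0}\binom{(r-1)h_i+K-1}{K-1}$.
   Context: $\mathbb N=\{1,2,\dots\}$, $\mathbb N_0=\{0,1,2,\dots\}$. A subset $M$ of an abelian group $G$ is a $K$-approximate submonoid if $0\in M$ and there is a finite $F\subseteq G$ with $|F|\le K$ and $M+M\subseteq F+M$. For subsets $X,Y$, $X+Y=\{x+y:x\in X,y\in Y\}$; for $h\in\mathbb N$, $hA$ is the $h$-fold sumset and $0A=\{0\}$. For $\mathbf h\in\mathbb N_0^q$, $\mathbf h\cdot\mathcal A=h_1A_1+\cdots+h_qA_q$ and $r\mathbf h=(rh_1,\dots,rh_q)$. -}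

module Defs where

open import Level using (Level; _⊔_)
open import Algebra.Bundles using (AbelianGroup)
open import Data.Nat using (ℕ; zero; suc; _*_; _∸_; _≤_)
open import Data.Nat.Combinatorics using (_C_)
open import Data.Fin using (Fin; zero; suc)
open import Data.List using (List; length)
open import Data.List.Membership.Propositional using (_∈_)
open import Data.Product using (Σ; ∃; _×_; _,_)
open import Relation.Unary using (Pred)

module _ {c ℓ : Level} (G : AbelianGroup c ℓ) where
  open AbelianGroup G

  _⊕_ : ∀ {p q} → Pred Carrier p → Pred Carrier q → Pred Carrier (c ⊔ ℓ ⊔ p ⊔ q)
  (X ⊕ Y) z = Σ Carrier λ x → Σ Carrier λ y → X x × Y y × (z ≈ x ∙ y)

  _⊆_ : ∀ {p q} → Pred Carrier p → Pred Carrier q → Set (c ⊔ p ⊔ q)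
  X ⊆ Y = ∀ {z} → X z → Y z

  listSet : List Carrier → Pred Carrier c
  listSet F x = x ∈ F

  ⟦_⟧ : Carrier → Pred Carrier ℓ
  ⟦ a ⟧ z = z ≈ a

  _·ₛ_ : ∀ {p} → ℕ → Pred Carrier p → Pred Carrier (c ⊔ ℓ ⊔ p)
  _·ₛ_ {p} zero A z = Level.Lift (c ⊔ p) (z ≈ ε)
  (suc h ·ₛ A) = (h ·ₛ A) ⊕ A

  IsApproxSubmonoid : ∀ {p} → ℕ → Pred Carrier p → Set (c ⊔ ℓ ⊔ p)
  IsApproxSubmonoid K M =
    M ε × Σ (List Carrier) λ F → length F ≤ K × ((M ⊕ M) ⊆ (listSet F ⊕ M))

  _·ᶠ_ : ∀ {p} {q : ℕ} → (Fin q → ℕ) → (Fin q → Pred Carrier p) → Pred Carrier (c ⊔ ℓ ⊔ p)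
  _·ᶠ_ {p} {q = zero} h A z = Level.Lift (c ⊔ p) (z ≈ ε)
  _·ᶠ_ {q = suc q} h A = (h zero ·ₛ A zero) ⊕ ((λ i → h (suc i)) ·ᶠ (λ i → A (suc i)))

factor : ℕ → ℕ → ℕ → ℕ
factor r zero K = 1
factor r (suc h) K = (((r ∸ 1) * suc h) Data.Nat.+ (K ∸ 1)) C (K ∸ 1)

boundProd : (q : ℕ) → ℕ → (Fin q → ℕ) → (Fin q → ℕ) → ℕ
boundProd zero r h K = 1
boundProd (suc q) r h K = factor r (h zero) (K zero) * boundProd q r (λ i → h (suc i)) (λ i → K (suc i))

{-# OPTIONS --safe #-}
module Submission where

-- If M + M ⊆ F + M, peeling off one copy of M at a time gives (j + n)M ⊆ Sⱼ(F) + nM for n ≥ 1,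
-- where Sⱼ(F) is the set of sums of j-element multisets from F; after padding F with zeros to
-- exactly K elements, |Sⱼ(F)| = C(j + K - 1, K - 1). For A = a + M and j = (r - 1)h this gives
-- (rh)A ⊆ (ja + Sⱼ(F)) + hA, and adding these coverings over the components multiplies the
-- sizes of the covering sets.

open import Level using (Level; lift; _⊔_)
open import Algebra.Bundles using (AbelianGroup)
open import Data.Nat using (ℕ; zero; suc; _+_; _*_; _∸_; _≤_; s≤s; z≤n)
open import Data.Nat.Properties using (+-comm; +-suc; *-zeroʳ; *-mono-≤; ≤-refl; ≤-reflexive; ≤-trans; m+[n∸m]≡n)
open import Data.Nat.Combinatorics using (_C_; nCn≡1; nCk+nC[k+1]≡[n+1]C[k+1])
open import Data.Fin using (Fin; zero; suc)
open import Data.List using (List; []; _∷_; [_]; _++_; map; replicate; length; cartesianProductWith)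
open import Data.List.Properties using (length-++; length-map; length-replicate)
open import Data.List.Membership.Propositional using (_∈_; find)
import Data.List.Membership.Propositional.Properties as Membershipₚ
import Data.List.Membership.Setoid as SetoidMembership
import Data.List.Membership.Setoid.Properties as SetoidMembershipₚ
open import Data.List.Relation.Unary.Any using (here; there)
open import Data.Product using (Σ; _×_; _,_)
open import Data.Sum using ([_,_]′)
open import Function using (id; _∘_)
open import Relation.Binary.PropositionalEquality as ≡ using (_≡_)
open import Relation.Unary using (Pred)
import Algebra.Properties.CommutativeSemigroup as CommutativeSemigroupₚ
import Algebra.Properties.Monoid.Mult as MonoidMultₚ
import Defs
open Defs using (factor; boundProd)

length-cartesianProductWith : ∀ {a b c} {A : Set a} {B : Set b} {C : Set c} (f : A → B → C) xs ys →
                              length (cartesianProductWith f xs ys) ≡ length xs * length ys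
length-cartesianProductWith f []       ys = ≡.refl
length-cartesianProductWith f (x ∷ xs) ys = ≡.trans (length-++ (map (f x) ys))
  (≡.cong₂ _+_ (length-map (f x) ys) (length-cartesianProductWith f xs ys))

module Sumsets {c ℓ} (G : AbelianGroup c ℓ) where
  open import Relation.Unary using (_⊆_; _⊆′_)
  open AbelianGroup G
  open CommutativeSemigroupₚ commutativeSemigroup using (interchange; x∙yz≈y∙xz)
  open MonoidMultₚ monoid using (×-homo-+) renaming (_×_ to _·_)
  open SetoidMembership setoid using () renaming (_∈_ to _∈≈_)
  open SetoidMembershipₚ using (∈-resp-≈; ∈-++⁺ˡ; ∈-++⁺ʳ; ∈-++⁻; ∈-map⁺; ∈-map⁻; ∈-cartesianProductWith⁺)

  infixr 6 _⊕_

  _⊕_ : ∀ {p q} → Pred Carrier p → Pred Carrier q → Pred Carrier (c ⊔ ℓ ⊔ p ⊔ q)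
  _⊕_ = Defs._⊕_ G

  ⟦_⟧ : Carrier → Pred Carrier ℓ
  ⟦_⟧ = Defs.⟦_⟧ G

  _·ₛ_ : ∀ {p} → ℕ → Pred Carrier p → Pred Carrier (c ⊔ ℓ ⊔ p)
  _·ₛ_ = Defs._·ₛ_ G

  _·ᶠ_ : ∀ {p q} → (Fin q → ℕ) → (Fin q → Pred Carrier p) → Pred Carrier (c ⊔ ℓ ⊔ p)
  _·ᶠ_ = Defs._·ᶠ_ G

  listSet : List Carrier → Pred Carrier c
  listSet = Defs.listSet G

  IsApproxSubmonoid : ∀ {p} → ℕ → Pred Carrier p → Set (c ⊔ ℓ ⊔ p)
  IsApproxSubmonoid = Defs.IsApproxSubmonoid G

  private variable
    p : Level
    W X Y Z X′ Y′ Z′ M : Pred Carrier _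
    n : ℕ
    x y : Carrier
    L L′ : List Carrier

  module ⊆-Reasoning where
    infix  1 begin_
    infixr 2 _⊆⟨_⟩_
    infix  3 _∎

    begin_ : X ⊆′ Y → X ⊆ Y
    begin X⊆Y = X⊆Y _

    _⊆⟨_⟩_ : (X : Pred Carrier p) → X ⊆ Y → Y ⊆′ Z → X ⊆′ Z
    X ⊆⟨ X⊆Y ⟩ Y⊆Z = λ x x∈X → Y⊆Z x (X⊆Y x∈X)

    _∎ : (X : Pred Carrier p) → X ⊆′ X
    X ∎ = λ _ x∈X → x∈X

  ⊕-mono : X ⊆ X′ → Y ⊆ Y′ → X ⊕ Y ⊆ X′ ⊕ Y′
  ⊕-mono X⊆X′ Y⊆Y′ (x , y , x∈X , y∈Y , z≈) = x , y , X⊆X′ x∈X , Y⊆Y′ y∈Y , z≈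

  ⊕-comm : X ⊕ Y ⊆ Y ⊕ X
  ⊕-comm (x , y , x∈X , y∈Y , z≈) = y , x , y∈Y , x∈X , trans z≈ (comm x y)

  ⊕-assocʳ : (X ⊕ Y) ⊕ Z ⊆ X ⊕ (Y ⊕ Z)
  ⊕-assocʳ (u , z , (x , y , x∈X , y∈Y , u≈) , z∈Z , w≈) =
    x , y ∙ z , x∈X , (y , z , y∈Y , z∈Z , refl) , trans w≈ (trans (∙-congʳ u≈) (assoc x y z))

  ⊕-assocˡ : X ⊕ (Y ⊕ Z) ⊆ (X ⊕ Y) ⊕ Z
  ⊕-assocˡ (x , u , x∈X , (y , z , y∈Y , z∈Z , u≈) , w≈) =
    x ∙ y , z , (x , y , x∈X , y∈Y , refl) , z∈Z , trans w≈ (trans (∙-congˡ u≈) (sym (assoc x y z)))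

  ⊕-interchange : (W ⊕ X) ⊕ (Y ⊕ Z) ⊆ (W ⊕ Y) ⊕ (X ⊕ Z)
  ⊕-interchange (u , v , (w , x , w∈W , x∈X , u≈) , (y , z , y∈Y , z∈Z , v≈) , t≈) =
    w ∙ y , x ∙ z , (w , y , w∈W , y∈Y , refl) , (x , z , x∈X , z∈Z , refl) ,
    trans t≈ (trans (∙-cong u≈ v≈) (interchange w x y z))

  ·ₛ-cong : ∀ {m n} → m ≡ n → m ·ₛ X ⊆ n ·ₛ X
  ·ₛ-cong ≡.refl = id

  ⟦⟧-⊕ : ⟦ x ⟧ ⊕ ⟦ y ⟧ ⊆ ⟦ x ∙ y ⟧
  ⟦⟧-⊕ (x′ , y′ , x′≈x , y′≈y , z≈) = trans z≈ (∙-cong x′≈x y′≈y)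

  ⟦⟧-split : ∀ {w} → w ≈ x ∙ y → ⟦ w ⟧ ⊆ ⟦ x ⟧ ⊕ ⟦ y ⟧
  ⟦⟧-split {x = x} {y} w≈ z≈w = x , y , refl , refl , trans z≈w w≈

  ε-⊕ : Y ⊆ (_∈≈ [ ε ]) ⊕ Y
  ε-⊕ y∈Y = ε , _ , here refl , y∈Y , sym (identityˡ _)

  ⟦⟧-⊕-∈≈ : ⟦ x ⟧ ⊕ (_∈≈ L) ⊆ (_∈≈ map (x ∙_) L)
  ⟦⟧-⊕-∈≈ (x′ , y , x′≈x , y∈L , z≈) =
    ∈-resp-≈ setoid (sym (trans z≈ (∙-congʳ x′≈x))) (∈-map⁺ setoid setoid ∙-congˡ y∈L)

  ∈≈-⊕ : (_∈≈ L) ⊕ (_∈≈ L′) ⊆ (_∈≈ cartesianProductWith _∙_ L L′)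
  ∈≈-⊕ (x , y , x∈L , y∈L′ , z≈) =
    ∈-resp-≈ setoid (sym z≈) (∈-cartesianProductWith⁺ setoid setoid setoid ∙-cong x∈L y∈L′)

  ∈≈-⊕⊆listSet-⊕ : (_∈≈ L) ⊕ Y ⊆ listSet L ⊕ Y
  ∈≈-⊕⊆listSet-⊕ (x , y , x∈L , y∈Y , z≈) =
    let w , w∈L , x≈w = find x∈L in w , y , w∈L , y∈Y , trans z≈ (∙-congʳ x≈w)

  -- sums n F lists the sums of the n-element multisets drawn from F, one entry per multiset:
  -- the head of F is either not used at all or used once more.
  sums : ℕ → List Carrier → List Carrier
  sums zero    _       = [ ε ]
  sums (suc n) []      = []
  sums (suc n) (f ∷ F) = sums (suc n) F ++ map (f ∙_) (sums n (f ∷ F))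

  length-sums : ∀ n {k} F → length F ≡ suc k → length (sums n F) ≡ (n + k) C k
  length-sums zero    {k} _           _      = ≡.sym (nCn≡1 k)
  length-sums (suc n)     (f ∷ [])    ≡.refl =
    ≡.trans (length-map (f ∙_) (sums n [ f ])) (length-sums n [ f ] ≡.refl)
  length-sums (suc n)     (f ∷ g ∷ F) ≡.refl = begin
    length (sums (suc n) (g ∷ F) ++ map (f ∙_) (sums n (f ∷ g ∷ F)))
      ≡⟨ length-++ (sums (suc n) (g ∷ F)) ⟩
    length (sums (suc n) (g ∷ F)) + length (map (f ∙_) (sums n (f ∷ g ∷ F)))
      ≡⟨ ≡.cong₂ _+_ (length-sums (suc n) (g ∷ F) ≡.refl)
                     (≡.trans (length-map (f ∙_) (sums n (f ∷ g ∷ F))) (length-sums n (f ∷ g ∷ F) ≡.refl)) ⟩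
    (suc n + m) C m + (n + suc m) C suc m
      ≡⟨ ≡.cong (λ t → suc (n + m) C m + t C suc m) (+-suc n m) ⟩
    suc (n + m) C m + suc (n + m) C suc m
      ≡⟨ nCk+nC[k+1]≡[n+1]C[k+1] (suc (n + m)) m ⟩
    suc (suc (n + m)) C suc m
      ≡⟨ ≡.cong (λ t → suc t C suc m) (+-suc n m) ⟨
    (suc n + suc m) C suc m ∎
    where
    open ≡.≡-Reasoning
    m = length F

  ∈-sums-suc : ∀ n {f y} F → f ∈ F → y ∈≈ sums n F → f ∙ y ∈≈ sums (suc n) F
  ∈-sums-suc n (f ∷ F) (here ≡.refl) y∈ =
    ∈-++⁺ʳ setoid (sums (suc n) F) (∈-map⁺ setoid setoid ∙-congˡ y∈)
  ∈-sums-suc zero (g ∷ F) (there f∈F) y∈ = ∈-++⁺ˡ setoid (∈-sums-suc zero F f∈F y∈)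
  ∈-sums-suc (suc n) {f} (g ∷ F) (there f∈F) y∈ =
    [ (λ y∈sumsF → ∈-++⁺ˡ setoid (∈-sums-suc (suc n) F f∈F y∈sumsF))
    , (λ y∈g+sums →
        let y′ , y′∈ , y≈g∙y′ = ∈-map⁻ setoid setoid y∈g+sums
        in ∈-++⁺ʳ setoid (sums (suc (suc n)) F)
             (∈-resp-≈ setoid (sym (trans (∙-congˡ y≈g∙y′) (x∙yz≈y∙xz f g y′)))
               (∈-map⁺ setoid setoid ∙-congˡ (∈-sums-suc n (g ∷ F) (there f∈F) y′∈))))
    ]′ (∈-++⁻ setoid (sums (suc n) F) y∈)

  listSet-⊕-sums : listSet L ⊕ (_∈≈ sums n L) ⊆ (_∈≈ sums (suc n) L)
  listSet-⊕-sums {L} (f , y , f∈L , y∈ , z≈) = ∈-resp-≈ setoid (sym z≈) (∈-sums-suc _ L f∈L y∈)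

  ·ₛ-translate⁺ : ∀ n a → n ·ₛ (⟦ a ⟧ ⊕ M) ⊆ ⟦ n · a ⟧ ⊕ (n ·ₛ M)
  ·ₛ-translate⁺ zero    a (lift z≈ε) = ε , ε , refl , lift refl , trans z≈ε (sym (identityˡ ε))
  ·ₛ-translate⁺ {M = M} (suc n) a = begin
    n ·ₛ (⟦ a ⟧ ⊕ M) ⊕ (⟦ a ⟧ ⊕ M)        ⊆⟨ ⊕-mono (·ₛ-translate⁺ n a) id ⟩
    (⟦ n · a ⟧ ⊕ n ·ₛ M) ⊕ (⟦ a ⟧ ⊕ M)    ⊆⟨ ⊕-interchange ⟩
    (⟦ n · a ⟧ ⊕ ⟦ a ⟧) ⊕ (n ·ₛ M ⊕ M)    ⊆⟨ ⊕-mono (⟦⟧-⊕ ∘ ⊕-comm) id ⟩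
    ⟦ suc n · a ⟧ ⊕ suc n ·ₛ M            ∎
    where open ⊆-Reasoning

  ·ₛ-translate⁻ : ∀ n a → ⟦ n · a ⟧ ⊕ (n ·ₛ M) ⊆ n ·ₛ (⟦ a ⟧ ⊕ M)
  ·ₛ-translate⁻ zero    a (x , y , x≈ε , lift y≈ε , z≈) = lift (trans z≈ (trans (∙-cong x≈ε y≈ε) (identityˡ ε)))
  ·ₛ-translate⁻ {M = M} (suc n) a = begin
    ⟦ suc n · a ⟧ ⊕ suc n ·ₛ M            ⊆⟨ ⊕-mono (⊕-comm ∘ ⟦⟧-split refl) id ⟩
    (⟦ n · a ⟧ ⊕ ⟦ a ⟧) ⊕ (n ·ₛ M ⊕ M)    ⊆⟨ ⊕-interchange ⟩
    (⟦ n · a ⟧ ⊕ n ·ₛ M) ⊕ (⟦ a ⟧ ⊕ M)    ⊆⟨ ⊕-mono (·ₛ-translate⁻ n a) id ⟩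
    n ·ₛ (⟦ a ⟧ ⊕ M) ⊕ (⟦ a ⟧ ⊕ M)        ∎
    where open ⊆-Reasoning

  module _ {F : List Carrier} (M⊕M⊆F⊕M : M ⊕ M ⊆ listSet F ⊕ M) where

    ·ₛ-reduce : ∀ j n → (j + suc n) ·ₛ M ⊆ (_∈≈ sums j F) ⊕ suc n ·ₛ M
    ·ₛ-reduce zero    n = ε-⊕
    ·ₛ-reduce (suc j) n = begin
      (j + suc n) ·ₛ M ⊕ M                           ⊆⟨ ⊕-mono (·ₛ-reduce j n) id ⟩
      ((_∈≈ sums j F) ⊕ n ·ₛ M ⊕ M) ⊕ M              ⊆⟨ ⊕-assocʳ ∘ ⊕-mono ⊕-assocˡ id ⟩
      ((_∈≈ sums j F) ⊕ n ·ₛ M) ⊕ (M ⊕ M)            ⊆⟨ ⊕-mono id M⊕M⊆F⊕M ⟩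
      ((_∈≈ sums j F) ⊕ n ·ₛ M) ⊕ (listSet F ⊕ M)    ⊆⟨ ⊕-interchange ⟩
      ((_∈≈ sums j F) ⊕ listSet F) ⊕ (n ·ₛ M ⊕ M)    ⊆⟨ ⊕-mono (listSet-⊕-sums ∘ ⊕-comm) id ⟩
      (_∈≈ sums (suc j) F) ⊕ suc n ·ₛ M              ∎
      where open ⊆-Reasoning

    ·ₛ-reduce-translate : ∀ j n a →
      (suc n + j) ·ₛ (⟦ a ⟧ ⊕ M) ⊆ (_∈≈ map (j · a ∙_) (sums j F)) ⊕ suc n ·ₛ (⟦ a ⟧ ⊕ M)
    ·ₛ-reduce-translate j n a = begin
      (suc n + j) ·ₛ (⟦ a ⟧ ⊕ M)                              ⊆⟨ ·ₛ-translate⁺ (suc n + j) a ⟩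
      ⟦ (suc n + j) · a ⟧ ⊕ (suc n + j) ·ₛ M                  ⊆⟨ ⊕-mono (⟦⟧-split (trans (×-homo-+ a (suc n) j) (comm _ _)))
                                                                         (·ₛ-cong (+-comm (suc n) j)) ⟩
      (⟦ j · a ⟧ ⊕ ⟦ suc n · a ⟧) ⊕ (j + suc n) ·ₛ M          ⊆⟨ ⊕-mono id (·ₛ-reduce j n) ⟩
      (⟦ j · a ⟧ ⊕ ⟦ suc n · a ⟧) ⊕ ((_∈≈ sums j F) ⊕ suc n ·ₛ M)
                                                              ⊆⟨ ⊕-interchange ⟩
      (⟦ j · a ⟧ ⊕ (_∈≈ sums j F)) ⊕ (⟦ suc n · a ⟧ ⊕ suc n ·ₛ M)
                                                              ⊆⟨ ⊕-mono ⟦⟧-⊕-∈≈ (·ₛ-translate⁻ (suc n) a) ⟩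
      (_∈≈ map (j · a ∙_) (sums j F)) ⊕ suc n ·ₛ (⟦ a ⟧ ⊕ M)  ∎
      where open ⊆-Reasoning

  paddedWitness : ∀ {K} → IsApproxSubmonoid K M → Σ (List Carrier) λ F → length F ≡ K × M ⊕ M ⊆ listSet F ⊕ M
  paddedWitness {K = K} (_ , F , |F|≤K , M⊕M⊆F⊕M) =
    F ++ replicate (K ∸ length F) ε ,
    ≡.trans (length-++ F) (≡.trans (≡.cong (length F +_) (length-replicate (K ∸ length F))) (m+[n∸m]≡n |F|≤K)) ,
    λ m∈M⊕M → ⊕-mono Membershipₚ.∈-++⁺ˡ id (M⊕M⊆F⊕M m∈M⊕M)

  CoveredBy : ∀ {p q} → ℕ → Pred Carrier p → Pred Carrier q → Set (c ⊔ ℓ ⊔ p ⊔ q)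
  CoveredBy b Z Y = Σ (List Carrier) λ X → length X ≤ b × Y ⊆ (_∈≈ X) ⊕ Z

  CoveredBy-refl : CoveredBy 1 Y Y
  CoveredBy-refl = [ ε ] , ≤-refl , ε-⊕

  CoveredBy-⊕ : ∀ {b b′} → CoveredBy b Z Y → CoveredBy b′ Z′ Y′ → CoveredBy (b * b′) (Z ⊕ Z′) (Y ⊕ Y′)
  CoveredBy-⊕ (X , |X|≤b , Y⊆X⊕Z) (X′ , |X′|≤b′ , Y′⊆X′⊕Z′) =
    cartesianProductWith _∙_ X X′ ,
    ≤-trans (≤-reflexive (length-cartesianProductWith _∙_ X X′)) (*-mono-≤ |X|≤b |X′|≤b′) ,
    λ y∈Y⊕Y′ → ⊕-mono ∈≈-⊕ id (⊕-interchange (⊕-mono Y⊆X⊕Z Y′⊆X′⊕Z′ y∈Y⊕Y′))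

  ·ₛ-dilate : ∀ {K} → 1 ≤ K → IsApproxSubmonoid K M → ∀ r′ h a →
              CoveredBy (factor (suc r′) h K) (h ·ₛ (⟦ a ⟧ ⊕ M)) ((suc r′ * h) ·ₛ (⟦ a ⟧ ⊕ M))
  ·ₛ-dilate _ _ r′ zero a = [ ε ] , ≤-refl , ε-⊕ ∘ ·ₛ-cong (*-zeroʳ r′)
  ·ₛ-dilate (s≤s z≤n) approx r′ (suc n) a =
    let F , |F|≡K , M⊕M⊆F⊕M = paddedWitness approx
        j = r′ * suc n
    in map (j · a ∙_) (sums j F) ,
       ≤-reflexive (≡.trans (length-map (j · a ∙_) (sums j F)) (length-sums j F |F|≡K)) ,
       ·ₛ-reduce-translate M⊕M⊆F⊕M j n a

  ·ᶠ-covered : ∀ {q} r (h K : Fin q → ℕ) (A : Fin q → Pred Carrier p) →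
               (∀ i → CoveredBy (factor r (h i) (K i)) (h i ·ₛ A i) ((r * h i) ·ₛ A i)) →
               CoveredBy (boundProd q r h K) (h ·ᶠ A) ((λ i → r * h i) ·ᶠ A)
  ·ᶠ-covered {q = zero}  r h K A _     = CoveredBy-refl
  ·ᶠ-covered {q = suc q} r h K A cover =
    CoveredBy-⊕ (cover zero) (·ᶠ-covered r (h ∘ suc) (K ∘ suc) (A ∘ suc) (cover ∘ suc))

open Defs

proposition2p10 : {c ℓ p : Level} (G : AbelianGroup c ℓ) (r : ℕ) → 1 ≤ r →
    (q : ℕ) (a : Fin q → AbelianGroup.Carrier G) (M : Fin q → Pred (AbelianGroup.Carrier G) p)
    (K : Fin q → ℕ) → (∀ i → 1 ≤ K i) → (∀ i → IsApproxSubmonoid G (K i) (M i)) →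
    (h : Fin q → ℕ) →
    Σ (List (AbelianGroup.Carrier G)) λ X →
      length X ≤ boundProd q r h K ×
      _⊆_ G (_·ᶠ_ G (λ i → r * h i) (λ i → _⊕_ G (⟦_⟧ G (a i)) (M i)))
            (_⊕_ G (listSet G X) (_·ᶠ_ G h (λ i → _⊕_ G (⟦_⟧ G (a i)) (M i))))
proposition2p10 G (suc r′) _ q a M K 1≤K approx h =
  let X , |X|≤bound , cover = ·ᶠ-covered (suc r′) h K (λ i → _⊕_ G (⟦_⟧ G (a i)) (M i))
                                (λ i → ·ₛ-dilate (1≤K i) (approx i) r′ (h i) (a i))
  in X , |X|≤bound , ∈≈-⊕⊆listSet-⊕ ∘ cover
  where open Sumsets G using (·ᶠ-covered; ·ₛ-dilate; ∈≈-⊕⊆listSet-⊕)
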